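{- Let $D$ be a strongly connected balanced bipartite digraph of order $2a$, where $a\geq 3$, let $k$ be an integer with $\max\{1,\frac{a}{4}\}<k\leq\frac{a}{2}$, and suppose that for every dominating pair $\{u,v\}$ of vertices in $D$, \[ d(u)\geq 2a-k\ \text{and}\ d(v)\geq a+k,\quad\text{or}\quad d(u)\geq a+k\ \text{and}\ d(v)\geq 2a-k. \] Suppose moreover that $D$ is not a directed cycle of length $2a$. Then for every vertex $u\in V(D)$ there exists a vertex $v\in V(D)\setminus\{u\}$ such that $\{u,v\}$ is a dominating pair. In particular, $d(u)\geq a+k$ for every $u\in V(D)$.
   Context: Digraphs have no loops and no multiple arcs. For a vertex $v$, $d(v)=d^+(v)+d^-(v)$ (out-degree plus in-degree). A pair of distinct vertices $\{u,v\}$ is dominating if there is a vertex $w$ with $uw$ and $vw$ both arcs of $D$. Balanced bipartite: two partite sets of equal size $a$. -}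

module Defs where

open import Data.Nat using (ℕ; zero; suc; _+_; _*_; _∸_)
open import Data.Bool using (Bool; true; false; T)
open import Data.Fin using (Fin; toℕ)
open import Data.List using (List; _++_; map)
open import Data.Nat.ListAction using (sum)
open import Data.List using (allFin)
open import Data.Sum using (_⊎_; inj₁; inj₂)
open import Data.Product using (Σ; ∃; ∃-syntax; _×_)
open import Relation.Binary.PropositionalEquality using (_≡_)
open import Relation.Nullary using (¬_)
open import Function.Definitions using (Injective)
open import Function.Bundles using (_⇔_)

-- Vertex set of a balanced bipartite digraph with partite sets of size a:
-- inj₁ i  are the vertices of X, inj₂ j  those of Y.
V : ℕ → Set
V a = Fin a ⊎ Fin a

-- A balanced bipartite digraph: an arc relation (Bool-valued, so no multiple arcs)
-- with no arcs inside a partite set (hence, in particular, no loops).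
record BBDigraph (a : ℕ) : Set where
  field
    arc     : V a → V a → Bool
    noArcXX : ∀ i j → arc (inj₁ i) (inj₁ j) ≡ false
    noArcYY : ∀ i j → arc (inj₂ i) (inj₂ j) ≡ false
open BBDigraph public

vertices : (a : ℕ) → List (V a)
vertices a = map inj₁ (allFin a) ++ map inj₂ (allFin a)

b2n : Bool → ℕ
b2n true  = 1
b2n false = 0

outdeg : ∀ {a} → BBDigraph a → V a → ℕ
outdeg {a} D v = sum (map (λ w → b2n (arc D v w)) (vertices a))

indeg : ∀ {a} → BBDigraph a → V a → ℕ
indeg {a} D v = sum (map (λ w → b2n (arc D w v)) (vertices a))

deg : ∀ {a} → BBDigraph a → V a → ℕ
deg D v = outdeg D v + indeg D v

Arc : ∀ {a} → BBDigraph a → V a → V a → Set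
Arc D u v = T (arc D u v)

data Reach {a : ℕ} (D : BBDigraph a) : V a → V a → Set where
  here : ∀ {u} → Reach D u u
  step : ∀ {u v w} → Arc D u v → Reach D v w → Reach D u w

StronglyConnected : ∀ {a} → BBDigraph a → Set
StronglyConnected {a} D = ∀ (u v : V a) → Reach D u v

DominatingPair : ∀ {a} → BBDigraph a → V a → V a → Set
DominatingPair {a} D u v = ¬ (u ≡ v) × ∃[ w ] (Arc D u w × Arc D v w)

CycSucc : (m : ℕ) → Fin m → Fin m → Set
CycSucc m i j = (toℕ j ≡ suc (toℕ i)) ⊎ (toℕ i ≡ m ∸ 1 × toℕ j ≡ 0)

-- D is a directed cycle of length 2a: an injective (hence bijective) enumeration
-- f of the 2a vertices such that the arcs are exactly f i → f (i+1 mod 2a).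
IsDirectedCycle : ∀ {a} → BBDigraph a → Set
IsDirectedCycle {a} D =
  Σ (Fin (a + a) → V a) λ f →
    Injective _≡_ _≡_ f ×
    (∀ x y → Arc D x y ⇔
       (∃[ i ] ∃[ j ] (x ≡ f i × y ≡ f j × CycSucc (a + a) i j)))

-- Call v a partner of u when {u,v} is a dominating pair.  The degree condition
-- gives d(u) ≥ a + k (> a + 1) whenever u has a partner.  Suppose u has none.
--  * If u → y then u is the only in-neighbour of y (another one, z, would make
--    {u,z} dominating), so d(y) ≤ a + 1 (at most a out-neighbours across the
--    bipartition, at most one in-neighbour); hence y has no partner either.
--  * By strong connectivity no vertex has a partner, so every vertex has at most
--    one in-neighbour.
--  * A strongly connected digraph on finitely many vertices in which in-neighbours
--    are unique is a directed Hamiltonian cycle: the successor map is an injective,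
--    hence bijective, self-map whose orbit from any vertex covers everything and
--    has period exactly 2a.  This contradicts the hypothesis.
module Submission where

open import Defs
open import Data.Nat using (ℕ; zero; suc; _+_; _*_; _∸_; _≤_; _<_; s≤s; s≤s⁻¹; z≤n; _<?_)
open import Data.Nat.Properties
open import Data.Fin as F using (Fin; toℕ; fromℕ<; join; splitAt; punchOut)
import Data.Fin.Properties as FP
open import Data.Product using (_×_; ∃-syntax; _,_; proj₁; proj₂; Σ; ∃)
open import Data.Sum using (_⊎_; inj₁; inj₂)
open import Data.Sum.Properties using (inj₂-injective; inj₁-injective; ≡-dec)
open import Data.Bool using (Bool; true; false; T)
open import Data.Unit using (tt)
open import Data.Empty using (⊥-elim)
open import Data.List using (map; allFin; tabulate; _++_)
open import Data.List.Properties using (map-++; map-tabulate; map-∘)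
open import Data.Nat.ListAction using (sum)
open import Data.Nat.ListAction.Properties using (sum-++)
open import Relation.Binary.PropositionalEquality
open import Relation.Nullary using (¬_; Dec; yes; no)
open import Relation.Nullary.Decidable using (¬?; _×-dec_; T?)
open import Relation.Binary using (tri<; tri≈; tri>)
open import Function using (_∘_)
open import Function.Bundles using (mk⇔)
open import Function.Definitions using (Injective)

-- An injective self-map of a finite set is surjective (otherwise it would
-- inject Fin (suc m) into the m remaining values, contradicting pigeonhole).
injective⇒surjective : ∀ {n} (g : Fin n → Fin n) → Injective _≡_ _≡_ g →
                       ∀ y → ∃ λ x → g x ≡ y
injective⇒surjective {suc m} g g-inj y with FP.any? (λ x → g x FP.≟ y)
... | yes hit = hit
... | no miss with FP.pigeonhole (n<1+n m) (λ x → punchOut (λ e → miss (x , sym e)))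
... | i , j , i<j , eq = ⊥-elim (<-irrefl (cong toℕ (g-inj gi≡gj)) i<j)
  where
    gi≡gj : g i ≡ g j
    gi≡gj = FP.punchOut-injective (λ e → miss (i , sym e)) (λ e → miss (j , sym e)) eq

toFin : ∀ {a} → V a → Fin (a + a)
toFin {a} = join a a

fromFin : ∀ {a} → Fin (a + a) → V a
fromFin {a} = splitAt a

toFin-injective : ∀ {a} → Injective _≡_ _≡_ (toFin {a})
toFin-injective {a} {x} {y} e =
  trans (sym (FP.splitAt-join a a x)) (trans (cong (splitAt a) e) (FP.splitAt-join a a y))

fromFin-injective : ∀ {a} → Injective _≡_ _≡_ (fromFin {a})
fromFin-injective {a} {i} {j} e =
  trans (sym (FP.join-splitAt a a i)) (trans (cong (join a a) e) (FP.join-splitAt a a j))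

injectiveV⇒surjective : ∀ {a} (g : V a → V a) → Injective _≡_ _≡_ g →
                        ∀ y → ∃ λ x → g x ≡ y
injectiveV⇒surjective g g-inj y
  with injective⇒surjective (toFin ∘ g ∘ fromFin)
         (fromFin-injective ∘ g-inj ∘ toFin-injective) (toFin y)
... | x , e = fromFin x , toFin-injective e

InUnique : ∀ {a} → BBDigraph a → Set
InUnique D = ∀ {x y v} → Arc D x v → Arc D y v → x ≡ y

-- A strongly connected D with unique in-neighbours is a directed cycle through
-- all 2a vertices, enumerated by iterating the successor map from a start s.
module ForcedCycle {a : ℕ} (D : BBDigraph a) (sc : StronglyConnected D)
                   (inU : InUnique D) (s : V a) (0<n : 0 < a + a) where

  -- Every vertex has an out-neighbour: the first step of a walk to a vertex
  -- on the other side.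
  someSucc : ∀ v → ∃ λ w → Arc D v w
  someSucc (inj₁ i) with sc (inj₁ i) (inj₂ i)
  ... | step {v = w} p _ = w , p
  someSucc (inj₂ i) with sc (inj₂ i) (inj₁ i)
  ... | step {v = w} p _ = w , p

  next : V a → V a
  next v = proj₁ (someSucc v)

  next-arc : ∀ v → Arc D v (next v)
  next-arc v = proj₂ (someSucc v)

  next-injective : Injective _≡_ _≡_ next
  next-injective {x} {y} e = inU (next-arc x) (subst (Arc D y) (sym e) (next-arc y))

  -- Out-neighbours are unique too: y has a preimage z under next, and z, x
  -- are both in-neighbours of y.
  arc⇒next : ∀ {x y} → Arc D x y → y ≡ next x
  arc⇒next {x} {y} p with injectiveV⇒surjective next next-injective y
  ... | z , e = trans (sym e) (cong next (inU (subst (Arc D z) e (next-arc z)) p))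

  iter : ℕ → V a → V a
  iter zero x = x
  iter (suc n) x = next (iter n x)

  iter-+ : ∀ m n x → iter (m + n) x ≡ iter m (iter n x)
  iter-+ zero n x = refl
  iter-+ (suc m) n x = cong next (iter-+ m n x)

  iter-injective : ∀ m {x y} → iter m x ≡ iter m y → x ≡ y
  iter-injective zero e = e
  iter-injective (suc m) e = iter-injective m (next-injective e)

  iter-next : ∀ m x → iter m (next x) ≡ next (iter m x)
  iter-next m x = trans (sym (iter-+ m 1 x)) (cong (λ k → iter k x) (+-comm m 1))

  -- Since the walk is forced, reachability means reachability by iteration.
  reach⇒iter : ∀ {x v} → Reach D x v → ∃ λ m → iter m x ≡ v
  reach⇒iter here = 0 , refl
  reach⇒iter {x} (step p r) with reach⇒iter r
  ... | m , e = suc m , trans (sym (iter-next m x)) (trans (cong (iter m) (sym (arc⇒next p))) e)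

  orbit : ℕ → V a
  orbit m = iter m s

  repeat⇒period : ∀ i j → i ≤ j → orbit i ≡ orbit j → orbit (j ∸ i) ≡ s
  repeat⇒period i j i≤j e = iter-injective i (trans (sym (iter-+ i (j ∸ i) s))
    (trans (cong orbit (m+[n∸m]≡n i≤j)) (sym e)))

  reduce : ∀ d → 0 < d → orbit d ≡ s → ∀ m → ∃ λ r → r < d × orbit m ≡ orbit r
  reduce d 0<d per zero = 0 , 0<d , refl
  reduce d 0<d per (suc m) with reduce d 0<d per m
  ... | r , r<d , e with suc r <? d
  ... | yes sr<d = suc r , sr<d , cong next e
  ... | no sr≮d = 0 , 0<d , trans (cong next e)
                   (trans (cong orbit (≤-antisym r<d (≮⇒≥ sr≮d))) per)

  index : ∀ d → 0 < d → orbit d ≡ s → ∀ v → Σ (Fin d) λ i → orbit (toℕ i) ≡ v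
  index d 0<d per v with reach⇒iter (sc s v)
  ... | m , em with reduce d 0<d per m
  ... | r , r<d , er = fromℕ< r<d ,
        trans (cong orbit (FP.toℕ-fromℕ< r<d)) (trans (sym er) em)

  -- No period is shorter than the number of vertices (pigeonhole on index).
  no-short-period : ∀ d → 0 < d → orbit d ≡ s → ¬ (d < a + a)
  no-short-period d 0<d per d<n with FP.pigeonhole d<n (λ i → proj₁ (index d 0<d per (fromFin i)))
  ... | i , j , i<j , eq = <-irrefl (cong toℕ (fromFin-injective same)) i<j
    where
      same : fromFin i ≡ fromFin j
      same = trans (sym (proj₂ (index d 0<d per (fromFin i))))
               (trans (cong (orbit ∘ toℕ) eq) (proj₂ (index d 0<d per (fromFin j))))

  -- The orbit closes after exactly 2a steps: among orbit 0 … orbit 2a two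
  -- points coincide, giving a period ≤ 2a, which cannot be shorter.
  full-period : orbit (a + a) ≡ s
  full-period with FP.pigeonhole (n<1+n (a + a)) (λ x → toFin (orbit (toℕ x)))
  ... | i , j , i<j , eq =
        subst (λ k → orbit k ≡ s) (≤-antisym d≤n (≮⇒≥ (no-short-period d 0<d per))) per
    where
      d = toℕ j ∸ toℕ i
      0<d : 0 < d
      0<d = m<n⇒0<n∸m i<j
      per : orbit d ≡ s
      per = repeat⇒period (toℕ i) (toℕ j) (<⇒≤ i<j) (toFin-injective eq)
      d≤n : d ≤ a + a
      d≤n = ≤-trans (m∸n≤m (toℕ j) (toℕ i)) (s≤s⁻¹ (FP.toℕ<n j))

  cycle : Fin (a + a) → V a
  cycle i = orbit (toℕ i)

  -- Distinct indices below 2a give distinct vertices, since a repetition would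
  -- be a period shorter than 2a.
  no-repeat : ∀ i j → toℕ i < toℕ j → ¬ (cycle i ≡ cycle j)
  no-repeat i j i<j e = no-short-period (toℕ j ∸ toℕ i) (m<n⇒0<n∸m i<j)
    (repeat⇒period (toℕ i) (toℕ j) (<⇒≤ i<j) e)
    (≤-<-trans (m∸n≤m (toℕ j) (toℕ i)) (FP.toℕ<n j))

  cycle-injective : Injective _≡_ _≡_ cycle
  cycle-injective {i} {j} e with <-cmp (toℕ i) (toℕ j)
  ... | tri< lt _ _ = ⊥-elim (no-repeat i j lt e)
  ... | tri≈ _ eq _ = FP.toℕ-injective eq
  ... | tri> _ _ gt = ⊥-elim (no-repeat j i gt (sym e))

  cycSucc⇒next : ∀ {i j} → CycSucc (a + a) i j → cycle j ≡ next (cycle i)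
  cycSucc⇒next (inj₁ e) = cong orbit e
  cycSucc⇒next {i} {j} (inj₂ (ei , ej)) = begin
    orbit (toℕ j)             ≡⟨ cong orbit ej ⟩
    s                         ≡⟨ sym full-period ⟩
    orbit (a + a)             ≡⟨ cong orbit (sym (m+[n∸m]≡n {1} 0<n)) ⟩
    orbit (suc (a + a ∸ 1))   ≡⟨ cong (orbit ∘ suc) (sym ei) ⟩
    next (orbit (toℕ i))      ∎
    where open ≡-Reasoning

  cycSucc-exists : ∀ i → ∃[ j ] CycSucc (a + a) i j
  cycSucc-exists i with suc (toℕ i) <? a + a
  ... | yes si<n = fromℕ< si<n , inj₁ (FP.toℕ-fromℕ< si<n)
  ... | no si≮n = fromℕ< 0<n ,
        inj₂ (cong (_∸ 1) (≤-antisym (FP.toℕ<n i) (≮⇒≥ si≮n)) , FP.toℕ-fromℕ< 0<n)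

  arc⇒cycSucc : ∀ x y → Arc D x y →
                ∃[ i ] ∃[ j ] (x ≡ cycle i × y ≡ cycle j × CycSucc (a + a) i j)
  arc⇒cycSucc x y p = i , j , sym ei , ey , succ
    where
      i : Fin (a + a)
      i = proj₁ (index (a + a) 0<n full-period x)
      ei : cycle i ≡ x
      ei = proj₂ (index (a + a) 0<n full-period x)
      j : Fin (a + a)
      j = proj₁ (cycSucc-exists i)
      succ : CycSucc (a + a) i j
      succ = proj₂ (cycSucc-exists i)
      ey : y ≡ cycle j
      ey = trans (arc⇒next p) (trans (cong next (sym ei)) (sym (cycSucc⇒next succ)))

  cycSucc⇒arc : ∀ x y → ∃[ i ] ∃[ j ] (x ≡ cycle i × y ≡ cycle j × CycSucc (a + a) i j) →
                Arc D x y
  cycSucc⇒arc x y (i , j , refl , refl , succ) =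
    subst (Arc D (cycle i)) (sym (cycSucc⇒next succ)) (next-arc (cycle i))

  isDirectedCycle : IsDirectedCycle D
  isDirectedCycle = cycle , cycle-injective , λ x y → mk⇔ (arc⇒cycSucc x y) (cycSucc⇒arc x y)

stronglyConnected-inUnique⇒cycle : ∀ {a} (D : BBDigraph a) → 0 < a →
  StronglyConnected D → InUnique D → IsDirectedCycle D
stronglyConnected-inUnique⇒cycle {suc a} D _ sc inU =
  ForcedCycle.isDirectedCycle D sc inU (inj₁ F.zero) (s≤s z≤n)

count : ∀ {n} → (Fin n → Bool) → ℕ
count h = sum (tabulate (b2n ∘ h))

count-≤ : ∀ {n} (h : Fin n → Bool) → count h ≤ n
count-≤ {zero} h = z≤n
count-≤ {suc n} h with h F.zero
... | true = s≤s (count-≤ (h ∘ F.suc))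
... | false = m≤n⇒m≤1+n (count-≤ (h ∘ F.suc))

count-none : ∀ {n} (h : Fin n → Bool) → (∀ i → h i ≡ false) → count h ≡ 0
count-none {zero} h none = refl
count-none {suc n} h none rewrite none F.zero = count-none (h ∘ F.suc) (none ∘ F.suc)

unique-at-zero : ∀ {n} (h : Fin (suc n) → Bool) → (∀ {i j} → T (h i) → T (h j) → i ≡ j) →
                 h F.zero ≡ true → ∀ i → h (F.suc i) ≡ false
unique-at-zero h u h0 i with h (F.suc i) in hi
... | false = refl
... | true with u {F.zero} {F.suc i} (subst T (sym h0) tt) (subst T (sym hi) tt)
... | ()

count-unique : ∀ {n} (h : Fin n → Bool) → (∀ {i j} → T (h i) → T (h j) → i ≡ j) →
               count h ≤ 1
count-unique {zero} h u = z≤n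
count-unique {suc n} h u with h F.zero in h0
... | true rewrite count-none (h ∘ F.suc) (unique-at-zero h u h0) = s≤s z≤n
... | false = count-unique (h ∘ F.suc) (λ p q → FP.suc-injective (u p q))

sum-vertices : ∀ {a} (g : V a → ℕ) →
  sum (map g (vertices a)) ≡ sum (tabulate (g ∘ inj₁)) + sum (tabulate (g ∘ inj₂))
sum-vertices {a} g = begin
  sum (map g (map inj₁ (allFin a) ++ map inj₂ (allFin a)))
    ≡⟨ cong sum (map-++ g (map inj₁ (allFin a)) (map inj₂ (allFin a))) ⟩
  sum (map g (map inj₁ (allFin a)) ++ map g (map inj₂ (allFin a)))
    ≡⟨ sum-++ (map g (map inj₁ (allFin a))) (map g (map inj₂ (allFin a))) ⟩
  sum (map g (map inj₁ (allFin a))) + sum (map g (map inj₂ (allFin a)))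
    ≡⟨ cong₂ _+_ (side inj₁) (side inj₂) ⟩
  sum (tabulate (g ∘ inj₁)) + sum (tabulate (g ∘ inj₂)) ∎
  where
    open ≡-Reasoning
    side : (ι : Fin a → V a) → sum (map g (map ι (allFin a))) ≡ sum (tabulate (g ∘ ι))
    side ι = cong sum (trans (sym (map-∘ (allFin a))) (map-tabulate (λ i → i) (g ∘ ι)))

-- If every in-neighbour of y is x, then d(y) ≤ a + 1: no arcs inside y's
-- partite set, at most a out-neighbours on the other side, one in-neighbour.
deg-single-in-neighbour : ∀ {a} (D : BBDigraph a) (x y : V a) →
  (∀ z → Arc D z y → z ≡ x) → deg D y ≤ a + 1
deg-single-in-neighbour {a} D x (inj₁ j) only-x
  rewrite sum-vertices (λ w → b2n (arc D (inj₁ j) w))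
        | sum-vertices (λ w → b2n (arc D w (inj₁ j)))
        | count-none (λ i → arc D (inj₁ j) (inj₁ i)) (noArcXX D j)
        | count-none (λ i → arc D (inj₁ i) (inj₁ j)) (λ i → noArcXX D i j)
  = +-mono-≤ (count-≤ (λ i → arc D (inj₁ j) (inj₂ i)))
      (count-unique (λ i → arc D (inj₂ i) (inj₁ j))
        (λ p q → inj₂-injective (trans (only-x _ p) (sym (only-x _ q)))))
deg-single-in-neighbour {a} D x (inj₂ j) only-x
  rewrite sum-vertices (λ w → b2n (arc D (inj₂ j) w))
        | sum-vertices (λ w → b2n (arc D w (inj₂ j)))
        | count-none (λ i → arc D (inj₂ j) (inj₂ i)) (noArcYY D j)
        | count-none (λ i → arc D (inj₂ i) (inj₂ j)) (λ i → noArcYY D i j)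
        | +-identityʳ (count (λ i → arc D (inj₂ j) (inj₁ i)))
        | +-identityʳ (count (λ i → arc D (inj₁ i) (inj₂ j)))
  = +-mono-≤ (count-≤ (λ i → arc D (inj₂ j) (inj₁ i)))
      (count-unique (λ i → arc D (inj₁ i) (inj₂ j))
        (λ p q → inj₁-injective (trans (only-x _ p) (sym (only-x _ q)))))

_≟V_ : ∀ {a} (x y : V a) → Dec (x ≡ y)
_≟V_ = ≡-dec FP._≟_ FP._≟_

anyV? : ∀ {a} (P : V a → Set) → (∀ v → Dec (P v)) → Dec (∃ P)
anyV? P P? with FP.any? (P? ∘ inj₁) | FP.any? (P? ∘ inj₂)
... | yes (i , p) | _ = yes (inj₁ i , p)
... | no _ | yes (j , p) = yes (inj₂ j , p)
... | no none₁ | no none₂ = no λ { (inj₁ i , p) → none₁ (i , p) ; (inj₂ j , p) → none₂ (j , p) }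

HasPartner : ∀ {a} → BBDigraph a → V a → Set
HasPartner D u = ∃[ v ] (¬ (v ≡ u) × DominatingPair D u v)

hasPartner? : ∀ {a} (D : BBDigraph a) u → Dec (HasPartner D u)
hasPartner? D u = anyV? _ (λ v → ¬? (v ≟V u) ×-dec ¬? (u ≟V v) ×-dec
                    anyV? _ (λ w → T? (arc D u w) ×-dec T? (arc D v w)))

-- Lemma 4.2 follows from the three facts below, for any bound b > a + 1 on the
-- degree of vertices with partners (here b = a + k with k > 1).
module NoPartner {a b : ℕ} (D : BBDigraph a) (sc : StronglyConnected D)
                 (partner⇒deg : ∀ {u} → HasPartner D u → b ≤ deg D u)
                 (a+1<b : a + 1 < b) where

  -- A vertex without partner is the unique in-neighbour of each out-neighbour,
  -- which therefore has degree ≤ a + 1 < b and so has no partner either.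
  propagates : ∀ {x y} → ¬ HasPartner D x → Arc D x y → ¬ HasPartner D y
  propagates {x} {y} lonely p partner =
    <-irrefl refl (<-≤-trans a+1<b (≤-trans (partner⇒deg partner)
                                     (deg-single-in-neighbour D x y only-x)))
    where
      only-x : ∀ z → Arc D z y → z ≡ x
      only-x z q with z ≟V x
      ... | yes e = e
      ... | no z≢x = ⊥-elim (lonely (z , z≢x , (λ e → z≢x (sym e)) , y , p , q))

  spreads : ∀ {x v} → ¬ HasPartner D x → Reach D x v → ¬ HasPartner D v
  spreads lonely here = lonely
  spreads lonely (step p r) = spreads (propagates lonely p) r

  lonely⇒inUnique : ∀ {u} → ¬ HasPartner D u → InUnique D
  lonely⇒inUnique {u} lonely {x} {y} {v} p q with x ≟V y
  ... | yes e = e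
  ... | no x≢y = ⊥-elim (spreads lonely (sc u x) (y , (λ e → x≢y (sym e)) , x≢y , v , p , q))

lemma4p2 : (a k : ℕ) (D : BBDigraph a) →
    3 ≤ a → 1 < k → a < 4 * k → 2 * k ≤ a →
    StronglyConnected D →
    (∀ u v → DominatingPair D u v →
        (2 * a ∸ k ≤ deg D u × a + k ≤ deg D v)
      ⊎ (a + k ≤ deg D u × 2 * a ∸ k ≤ deg D v)) →
    ¬ IsDirectedCycle D →
    (∀ u → ∃[ v ] (¬ (v ≡ u) × DominatingPair D u v))
      × (∀ u → a + k ≤ deg D u)
lemma4p2 a k D 3≤a 1<k _ 2k≤a sc degCond notCycle = partner , λ u → partner⇒deg (partner u)
  where
    -- 2k ≤ a gives a + k ≤ 2a - k, so either alternative yields d(u) ≥ a + k.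
    a+k≤2a∸k : a + k ≤ 2 * a ∸ k
    a+k≤2a∸k = m+n≤o⇒m≤o∸n (a + k) (begin
      a + k + k        ≡⟨ +-assoc a k k ⟩
      a + (k + k)      ≡⟨ cong (λ t → a + (k + t)) (sym (+-identityʳ k)) ⟩
      a + 2 * k        ≤⟨ +-monoʳ-≤ a (≤-trans 2k≤a (≤-reflexive (sym (+-identityʳ a)))) ⟩
      2 * a            ∎)
      where open ≤-Reasoning

    partner⇒deg : ∀ {u} → HasPartner D u → a + k ≤ deg D u
    partner⇒deg {u} (v , _ , dom) with degCond u v dom
    ... | inj₁ (du , _) = ≤-trans a+k≤2a∸k du
    ... | inj₂ (du , _) = du

    partner : ∀ u → HasPartner D u
    partner u with hasPartner? D u
    ... | yes found = found
    ... | no lonely = ⊥-elim (notCycle (stronglyConnected-inUnique⇒cycle D (≤-trans (s≤s z≤n) 3≤a)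
                        sc (NoPartner.lonely⇒inUnique D sc partner⇒deg (+-monoʳ-< a 1<k) lonely)))
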